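{- Let $k\geq 2$, $J\geq 0$ and $i\in\{1,\dots,k\}$, and let ${}^J_ih^{(j)}_1(q)$ be as in the context. Then the limit ${}^J_ih^{(\infty)}_1(q):=\lim_{j\to\infty}{}^J_ih^{(j)}_1(q)$ exists and equals $\sum_\lambda q^{|\lambda|}$, the sum over all partitions $\lambda=(b_1,\dots,b_s)$, $b_1\geq\cdots\geq b_s$, satisfying: (1) no odd part is repeated; (2) $b_p-b_{p+k-1}\geq 2$ whenever $p+k-1\leq s$ and $b_p$ is odd; (3) $b_p-b_{p+k-1}>2$ whenever $p+k-1\leq s$ and $b_p$ is even; (4) the smallest part satisfies $b_s>2J$; (5) at most $k-i$ parts are equal to $2J+1$ or $2J+2$.
   Context: $q$ is a formal variable. Fix $k\geq 2$. For each $j\geq 1$ let $\mathbf{A}'_{(j)}$ be the $k\times k$ matrix with $(r,c)$ entry $[c\leq k-r+1]\,q^{2j(c-1)}+[c\leq k-r]\,q^{2jc-1}$ ($[P]$ is $1$ if $P$ holds, $0$ otherwise). For an integer $J\geq 0$ let ${}^J\mathbf{h}^{(J)}$ be the identity matrix and ${}^J\mathbf{h}^{(j)}=\mathbf{A}'_{(J+1)}\cdots\mathbf{A}'_{(j)}$ for $j>J$; let ${}^J_ih^{(j)}_l(q)$ denote its $(i,l)$ entry. A sequence $H_j(q)$ of formal power series has a limit if for every $t\geq 0$ the coefficient of $q^t$ in $H_j(q)$ is independent of $j$ for all sufficiently large $j$; the limit is the power series with these stable coefficients. The empty partition is allowed (size $0$). -}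

module Defs where

open import Data.Nat using (ℕ; zero; suc; _+_; _*_; _∸_; _≤_; _<_; _≡ᵇ_)
open import Data.Nat.Divisibility using (_∣_)
open import Data.Bool using (Bool; true; false; if_then_else_; _∨_)
open import Data.List using (List; []; _∷_; length; lookup; filterᵇ)
open import Data.Fin using (Fin; toℕ)
import Data.Fin as F
open import Data.Product using (Σ; _×_; ∃)
open import Relation.Binary.PropositionalEquality using (_≡_; _≢_)
open import Relation.Nullary using (¬_)

-- Formal power series in q with ℕ coefficients: t ↦ coefficient of q^t.
Series : Set
Series = ℕ → ℕ

sumFrom : ℕ → ℕ → (ℕ → ℕ) → ℕ
sumFrom lo zero    f = 0
sumFrom lo (suc n) f = f lo + sumFrom (suc lo) n f

zeroS : Series
zeroS _ = 0

mono : ℕ → Series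
mono e t = if t ≡ᵇ e then 1 else 0

_⊕_ : Series → Series → Series
(f ⊕ g) t = f t + g t

_⊗_ : Series → Series → Series
(f ⊗ g) t = sumFrom 0 (suc t) (λ a → f a * g (t ∸ a))

ifLe : ℕ → ℕ → Series → Series
ifLe c n f = if c Data.Nat.≤ᵇ n then f else zeroS

-- k×k matrices, indexed 1-based by (row, column) ∈ {1..k}²
Mat : Set
Mat = ℕ → ℕ → Series

idMat : Mat
idMat r c = if r ≡ᵇ c then mono 0 else zeroS

mulMat : ℕ → Mat → Mat → Mat
mulMat k A B r c t = sumFrom 1 k (λ m → (A r m ⊗ B m c) t)

A′ : ℕ → ℕ → Mat
A′ k j r c = ifLe c ((k ∸ r) + 1) (mono (2 * j * (c ∸ 1)))
           ⊕ ifLe c (k ∸ r) (mono (2 * j * c ∸ 1))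

hprod : ℕ → ℕ → ℕ → Mat
hprod k J zero    = idMat
hprod k J (suc n) = mulMat k (hprod k J n) (A′ k (J + suc n))

-- ^J h^(j) (meaningful for j ≥ J; equals identity for j = J)
hMat : ℕ → ℕ → ℕ → Mat
hMat k J j = hprod k J (j ∸ J)

Even : ℕ → Set
Even n = 2 ∣ n

Odd : ℕ → Set
Odd n = ¬ (2 ∣ n)

-- A list (b_1,...,b_s) read via 0-based positions.
part : (l : List ℕ) → Fin (length l) → ℕ
part l p = lookup l p

IsPartition : List ℕ → Set
IsPartition l = (∀ p → 1 ≤ part l p)
              × (∀ p q → p F.≤ q → part l q ≤ part l p)

countBorder : ℕ → List ℕ → ℕ
countBorder J l = length (filterᵇ (λ b → (b ≡ᵇ 2 * J + 1) ∨ (b ≡ᵇ 2 * J + 2)) l)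

Conditions : (k J i : ℕ) → List ℕ → Set
Conditions k J i l =
    (∀ p q → p ≢ q → part l p ≡ part l q → ¬ Odd (part l p))
  × (∀ p q → toℕ q ≡ toℕ p + (k ∸ 1) →
        (Odd (part l p) → part l q + 2 ≤ part l p)
      × (Even (part l p) → part l q + 2 < part l p))
    -- (4) smallest part > 2J (equivalently, every part > 2J)
  × (∀ p → 2 * J < part l p)
  × (countBorder J l ≤ k ∸ i)

-- "n is the number of lists satisfying P": an enumeration by Fin n that is
-- injective and exhausts P.
Counts : ℕ → (List ℕ → Set) → Set
Counts n P = Σ (Fin n → List ℕ) λ f →
    (∀ x → P (f x))
  × (∀ x y → f x ≡ f y → x ≡ y)
  × (∀ l → P l → ∃ λ x → f x ≡ l)

module Submission where

-- Write  h⁽ⁿ⁾ = A'_(J+1) ⋯ A'_(J+n)  and  level n = 2(J+n).  By induction on n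
-- we show that the q^t coefficient of the (i,l) entry of h⁽ⁿ⁾ counts the
-- partitions of t satisfying (1)–(5) whose parts are at most  level n  and in
-- which  level n  occurs exactly l-1 times  ('Counted n i l t').
--
-- Step n → n+1, with  2+c = level (n+1):  the (m,l) entry of A'_(J+n+1) is
-- q^{(2+c)(l-1)} + q^{(2+c)l-1}, i.e. a block of l-1 parts 2+c followed by
-- e ∈ {0,1} parts 1+c ('topBlock'); its guards  [l ≤ k-m+1], [l ≤ k-m]  say
-- L + e + y₀ ≤ k-1  for  L = l-1,  y₀ = m-1.  Conversely every counted
-- partition splits uniquely as a top block followed by a partition from
-- stage n with y₀ parts equal to c, and conditions (2),(3) across the
-- junction are exactly that bound ('window-++').  At the first stage the
-- identity matrix supplies i-1 phantom parts, and the bound is condition (5).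
-- Once  level n > t  no part can reach the top, so the (i,1) entry counts all
-- partitions of t with (1)–(5): this is the limit, reached from j = J+t+1 on.

open import Defs
open import Data.Nat using (ℕ; zero; suc; _+_; _*_; _∸_; _≤_; _<_; z≤n; s≤s; _≡ᵇ_; _≤ᵇ_)
open import Data.Nat.Properties
open import Data.Nat.Divisibility using (_∣_; ∣-refl; ∣m∣n⇒∣m+n; ∣m+n∣m⇒∣n; ∣1⇒≡1; m∣m*n)
open import Data.Nat.ListAction using (sum)
open import Data.Nat.ListAction.Properties using (sum-++)
open import Data.Bool using (Bool; true; false; T; if_then_else_; _∨_)
open import Data.Unit using (⊤; tt)
open import Data.List using (List; []; _∷_; _++_; length; drop; replicate; lookup; filter)
open import Data.List.Properties using (length-replicate; length-++; ++-assoc; ++-identityʳ; ∷-injective; filter-++; filter-none; filter-all)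
open import Data.Bool.Properties using (T-∨)
open import Relation.Nullary.Decidable using (T?)
open import Data.List.Relation.Unary.All using (All; []; _∷_; zipWith) renaming (map to all-map)
open import Data.List.Relation.Unary.All.Properties using (++⁺; ++⁻ˡ; ++⁻ʳ; drop⁺; replicate⁺)
open import Data.Fin using (Fin; toℕ) renaming (zero to fzero; suc to fsuc)
import Data.Fin as F
open import Data.Fin.Properties using (+↔⊎; *↔×) renaming (suc-injective to fsuc-injective)
open import Data.Product using (Σ; _×_; _,_; proj₁; proj₂; ∃)
open import Data.Sum using (_⊎_; inj₁; inj₂)
open import Data.Empty using (⊥; ⊥-elim)
open import Function.Bundles using (_⇔_; mk⇔; _↔_; Inverse; Equivalence)
open import Relation.Binary.PropositionalEquality
open import Relation.Nullary using (¬_; Dec; yes; no)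

open Equivalence using (to; from)

Enumeration : Set → (List ℕ → Set) → Set
Enumeration A P = Σ (A → List ℕ) λ f →
    (∀ x → P (f x))
  × (∀ x y → f x ≡ f y → x ≡ y)
  × (∀ l → P l → ∃ λ x → f x ≡ l)

enum-⇔ : ∀ {A} {P R : List ℕ → Set} → Enumeration A P → (∀ l → P l ⇔ R l) → Enumeration A R
enum-⇔ (f , valid , inj , surj) P⇔R =
  f , (λ x → to (P⇔R _) (valid x)) , inj , λ l r → surj l (from (P⇔R l) r)

enum-reindex : ∀ {A B} {P : List ℕ → Set} → A ↔ B → Enumeration B P → Enumeration A P
enum-reindex {P = P} A↔B (f , valid , inj , surj) =
  f∘to , (λ x → valid (to↔ x)) , inj′ , surj′
  where
  open Inverse A↔B renaming (to to to↔; from to from↔)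
  f∘to = λ x → f (to↔ x)
  inj′ : ∀ x y → f∘to x ≡ f∘to y → x ≡ y
  inj′ x y e = begin
    x               ≡⟨ sym (strictlyInverseʳ x) ⟩
    from↔ (to↔ x)   ≡⟨ cong from↔ (inj _ _ e) ⟩
    from↔ (to↔ y)   ≡⟨ strictlyInverseʳ y ⟩
    y               ∎
    where open ≡-Reasoning
  surj′ : ∀ l → P l → ∃ λ x → f∘to x ≡ l
  surj′ l p with surj l p
  ... | b , fb≡l = from↔ b , trans (cong f (strictlyInverseˡ b)) fb≡l

counts-∅ : ∀ {P : List ℕ → Set} → (∀ l → ¬ P l) → Counts 0 P
counts-∅ ¬P = (λ ()) , (λ ()) , (λ ()) , λ l p → ⊥-elim (¬P l p)

counts-single : ∀ (l₀ : List ℕ) → Counts 1 (λ l → l ≡ l₀)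
counts-single l₀ = (λ _ → l₀) , (λ _ → refl) , (λ { fzero fzero _ → refl }) , λ l e → fzero , sym e

enum-⊎ : ∀ {A B} {P R : List ℕ → Set} → Enumeration A P → Enumeration B R →
  (∀ l → P l → R l → ⊥) → Enumeration (A ⊎ B) (λ l → P l ⊎ R l)
enum-⊎ {P = P} {R} (f , f-valid , f-inj , f-surj) (g , g-valid , g-inj , g-surj) disjoint =
  h , valid , inj , surj
  where
  h : _ ⊎ _ → List ℕ
  h (inj₁ a) = f a
  h (inj₂ b) = g b
  valid : ∀ x → P (h x) ⊎ R (h x)
  valid (inj₁ a) = inj₁ (f-valid a)
  valid (inj₂ b) = inj₂ (g-valid b)
  inj : ∀ x y → h x ≡ h y → x ≡ y
  inj (inj₁ a) (inj₁ a′) e = cong inj₁ (f-inj a a′ e)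
  inj (inj₂ b) (inj₂ b′) e = cong inj₂ (g-inj b b′ e)
  inj (inj₁ a) (inj₂ b) e = ⊥-elim (disjoint (f a) (f-valid a) (subst R (sym e) (g-valid b)))
  inj (inj₂ b) (inj₁ a) e = ⊥-elim (disjoint (f a) (f-valid a) (subst R e (g-valid b)))
  surj : ∀ l → P l ⊎ R l → ∃ λ x → h x ≡ l
  surj l (inj₁ p) = let (a , e) = f-surj l p in inj₁ a , e
  surj l (inj₂ r) = let (b , e) = g-surj l r in inj₂ b , e

enum-++ : ∀ {A B} {P R : List ℕ → Set} → Enumeration A P → Enumeration B R →
  (∀ {x y x′ y′} → P x → R y → P x′ → R y′ → y ++ x ≡ y′ ++ x′ → x ≡ x′ × y ≡ y′) →
  Enumeration (A × B) (λ l → ∃ λ x → ∃ λ y → P x × R y × l ≡ y ++ x)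
enum-++ {P = P} {R} (f , f-valid , f-inj , f-surj) (g , g-valid , g-inj , g-surj) unique =
  h , valid , inj , surj
  where
  h : _ × _ → List ℕ
  h (a , b) = g b ++ f a
  valid : ∀ z → ∃ λ x → ∃ λ y → P x × R y × h z ≡ y ++ x
  valid (a , b) = f a , g b , f-valid a , g-valid b , refl
  inj : ∀ z z′ → h z ≡ h z′ → z ≡ z′
  inj (a , b) (a′ , b′) e =
    let (x≡x′ , y≡y′) = unique (f-valid a) (g-valid b) (f-valid a′) (g-valid b′) e
    in cong₂ _,_ (f-inj a a′ x≡x′) (g-inj b b′ y≡y′)
  surj : ∀ l → (∃ λ x → ∃ λ y → P x × R y × l ≡ y ++ x) → ∃ λ z → h z ≡ l
  surj l (x , y , px , ry , l≡y++x) =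
    let (a , fa≡x) = f-surj x px ; (b , gb≡y) = g-surj y ry
    in (a , b) , trans (cong₂ _++_ gb≡y fa≡x) (sym l≡y++x)

counts-⊎ : ∀ {n m} {P R : List ℕ → Set} → Counts n P → Counts m R →
  (∀ l → P l → R l → ⊥) → Counts (n + m) (λ l → P l ⊎ R l)
counts-⊎ cP cR disjoint = enum-reindex +↔⊎ (enum-⊎ cP cR disjoint)

counts-++ : ∀ {n m} {P R : List ℕ → Set} → Counts n P → Counts m R →
  (∀ {x y x′ y′} → P x → R y → P x′ → R y′ → y ++ x ≡ y′ ++ x′ → x ≡ x′ × y ≡ y′) →
  Counts (n * m) (λ l → ∃ λ x → ∃ λ y → P x × R y × l ≡ y ++ x)
counts-++ cP cR unique = enum-reindex *↔× (enum-++ cP cR unique)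

counts-sumFrom : ∀ lo n (f : ℕ → ℕ) (P : ℕ → List ℕ → Set) →
  (∀ a → lo ≤ a → a < lo + n → Counts (f a) (P a)) →
  (∀ {a b l} → P a l → P b l → a ≡ b) →
  Counts (sumFrom lo n f) (λ l → ∃ λ a → lo ≤ a × a < lo + n × P a l)
counts-sumFrom lo zero f P _ _ =
  counts-∅ λ { l (a , lo≤a , a<lo+0 , _) → <⇒≱ a<lo+0 (≤-trans (≤-reflexive (+-identityʳ lo)) lo≤a) }
counts-sumFrom lo (suc n) f P count disjoint =
  enum-⇔ (counts-⊎ (count lo ≤-refl lo<lo+1+n) rest λ { l p (a , lo<a , _ , pa) → <⇒≢ lo<a (disjoint p pa) })
         λ l → mk⇔ forward backward
  where
  lo<lo+1+n : lo < lo + suc n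
  lo<lo+1+n = m<m+n lo (s≤s z≤n)
  rest = counts-sumFrom (suc lo) n f P
           (λ a lo<a a<end → count a (<⇒≤ lo<a) (≤-trans a<end (≤-reflexive (sym (+-suc lo n))))) disjoint
  forward : ∀ {l} → P lo l ⊎ (∃ λ a → suc lo ≤ a × a < suc lo + n × P a l) →
            ∃ λ a → lo ≤ a × a < lo + suc n × P a l
  forward (inj₁ p) = lo , ≤-refl , lo<lo+1+n , p
  forward (inj₂ (a , lo<a , a<end , p)) = a , <⇒≤ lo<a , ≤-trans a<end (≤-reflexive (sym (+-suc lo n))) , p
  backward : ∀ {l} → (∃ λ a → lo ≤ a × a < lo + suc n × P a l) →
             P lo l ⊎ (∃ λ a → suc lo ≤ a × a < suc lo + n × P a l)
  backward (a , lo≤a , a<end , p) with lo ≟ a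
  ... | yes refl = inj₁ p
  ... | no lo≢a = inj₂ (a , ≤∧≢⇒< lo≤a lo≢a , ≤-trans a<end (≤-reflexive (+-suc lo n)) , p)

counts-if : ∀ {n} {Q : Set} {P : List ℕ → Set} (b : Bool) (f : Series) →
  (T b → Q) → (Q → T b) → Counts (f n) P →
  Counts ((if b then f else zeroS) n) (λ y → Q × P y)
counts-if true  f b⇒Q Q⇒b c = enum-⇔ c λ y → mk⇔ (λ p → b⇒Q tt , p) proj₂
counts-if false f b⇒Q Q⇒b c = counts-∅ λ y qp → Q⇒b (proj₁ qp)

counts-mono : ∀ e t (y₀ : List ℕ) → Counts (mono e t) (λ y → t ≡ e × y ≡ y₀)
counts-mono e t y₀ with t ≡ᵇ e in eq
... | true  = enum-⇔ (counts-single y₀) λ y → mk⇔ (λ y≡y₀ → ≡ᵇ⇒≡ t e (subst T (sym eq) tt) , y≡y₀) proj₂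
... | false = counts-∅ λ { y (refl , _) → subst T eq (≡⇒≡ᵇ t t refl) }

even-double : ∀ a → Even (2 * a)
even-double a = m∣m*n a

even-+2 : ∀ {c} → Even c → Even (2 + c)
even-+2 ev = ∣m∣n⇒∣m+n ∣-refl ev

even⇒odd-suc : ∀ {c} → Even c → Odd (suc c)
even⇒odd-suc {c} ev 2∣1+c with ∣1⇒≡1 (∣m+n∣m⇒∣n (subst (2 ∣_) (+-comm 1 c) 2∣1+c) ev)
... | ()

Gap : ℕ → ℕ → Set
Gap x z = (Odd x → z + 2 ≤ x) × (Even x → z + 2 < x)

gap-even-top : ∀ {c} z → Even c → Gap (2 + c) z ⇔ (z < c)
gap-even-top {c} z ev = mk⇔
  (λ gap → ≤-pred (≤-pred (subst (λ w → suc w ≤ 2 + c) (+-comm z 2) (proj₂ gap (even-+2 ev)))))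
  (λ z<c → (λ odd → ⊥-elim (odd (even-+2 ev))) ,
           (λ _ → subst (λ w → suc w ≤ 2 + c) (+-comm 2 z) (s≤s (s≤s z<c))))

gap-odd-top : ∀ {c} z → Even c → Gap (1 + c) z ⇔ (z < c)
gap-odd-top {c} z ev = mk⇔
  (λ gap → ≤-pred (subst (_≤ 1 + c) (+-comm z 2) (proj₁ gap (even⇒odd-suc ev))))
  (λ z<c → (λ _ → subst (_≤ 1 + c) (+-comm 2 z) (s≤s z<c)) ,
           (λ even → ⊥-elim (even⇒odd-suc ev even)))

gap-irrefl : ∀ v → ¬ Gap v v
gap-irrefl v gap = m+1+n≰m v (proj₁ gap (λ ev → m+n≮m v 2 (proj₂ gap ev)))

Descending : List ℕ → Set
Descending []      = ⊤
Descending (x ∷ r) = All (_≤ x) r × Descending r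

OddDistinct : List ℕ → Set
OddDistinct []      = ⊤
OddDistinct (x ∷ r) = All (λ y → y ≡ x → ¬ Odd x) r × OddDistinct r

GapToHead : ℕ → List ℕ → Set
GapToHead x []      = ⊤
GapToHead x (z ∷ _) = Gap x z

-- Conditions (2),(3) for windows of length d+2: every part has the gap to the
-- part d+1 positions further on.
Window : ℕ → List ℕ → Set
Window d []      = ⊤
Window d (x ∷ r) = GapToHead x (drop d r) × Window d r

all⇔lookup : ∀ {P : ℕ → Set} l → (∀ p → P (part l p)) ⇔ All P l
all⇔lookup []      = mk⇔ (λ _ → []) (λ _ ())
all⇔lookup (x ∷ l) = mk⇔
  (λ h → h fzero ∷ to (all⇔lookup l) (λ p → h (fsuc p)))
  (λ { (px ∷ _) fzero → px ; (_ ∷ a) (fsuc p) → from (all⇔lookup l) a p })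

descending⇔ : ∀ l → (∀ p q → p F.≤ q → part l q ≤ part l p) ⇔ Descending l
descending⇔ []      = mk⇔ (λ _ → tt) (λ _ ())
descending⇔ (x ∷ l) = mk⇔
  (λ h → to (all⇔lookup l) (λ q → h fzero (fsuc q) z≤n) ,
         to (descending⇔ l) (λ p q p≤q → h (fsuc p) (fsuc q) (s≤s p≤q)))
  backward
  where
  backward : Descending (x ∷ l) → ∀ p q → p F.≤ q → part (x ∷ l) q ≤ part (x ∷ l) p
  backward _       fzero    fzero    _         = ≤-refl
  backward (a , _) fzero    (fsuc q) _         = from (all⇔lookup l) a q
  backward (_ , d) (fsuc p) (fsuc q) (s≤s p≤q) = from (descending⇔ l) d p q p≤q

oddDistinct⇔ : ∀ l → (∀ p q → p ≢ q → part l p ≡ part l q → ¬ Odd (part l p)) ⇔ OddDistinct l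
oddDistinct⇔ []      = mk⇔ (λ _ → tt) (λ _ ())
oddDistinct⇔ (x ∷ l) = mk⇔
  (λ h → to (all⇔lookup l) (λ q e → h fzero (fsuc q) (λ ()) (sym e)) ,
         to (oddDistinct⇔ l) (λ p q p≢q → h (fsuc p) (fsuc q) (λ e → p≢q (fsuc-injective e))))
  backward
  where
  backward : OddDistinct (x ∷ l) →
             ∀ p q → p ≢ q → part (x ∷ l) p ≡ part (x ∷ l) q → ¬ Odd (part (x ∷ l) p)
  backward _       fzero    fzero    p≢q _ = ⊥-elim (p≢q refl)
  backward (a , _) fzero    (fsuc q) _   e = from (all⇔lookup l) a q (sym e)
  backward (a , _) (fsuc p) fzero    _   e = subst (λ w → ¬ Odd w) (sym e) (from (all⇔lookup l) a p e)
  backward (_ , d) (fsuc p) (fsuc q) p≢q e = from (oddDistinct⇔ l) d p q (λ p≡q → p≢q (cong fsuc p≡q)) e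

drop⇒lookup : ∀ d (r : List ℕ) {z w} → drop d r ≡ z ∷ w →
  ∃ λ (q : Fin (length r)) → toℕ q ≡ d × lookup r q ≡ z
drop⇒lookup zero    (x ∷ r) refl = fzero , refl , refl
drop⇒lookup (suc d) (x ∷ r) e    =
  let (q , q≡d , r[q]≡z) = drop⇒lookup d r e in fsuc q , cong suc q≡d , r[q]≡z

lookup⇒drop : ∀ d (r : List ℕ) (q : Fin (length r)) → toℕ q ≡ d → ∃ λ w → drop d r ≡ lookup r q ∷ w
lookup⇒drop zero    (x ∷ r) fzero    _ = r , refl
lookup⇒drop (suc d) (x ∷ r) (fsuc q) e = lookup⇒drop d r q (suc-injective e)

window⇔ : ∀ d l →
  (∀ p q → toℕ q ≡ toℕ p + suc d → Gap (part l p) (part l q)) ⇔ Window d l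
window⇔ d []      = mk⇔ (λ _ → tt) (λ _ ())
window⇔ d (x ∷ l) = mk⇔
  (λ h → gapToHead h (drop d l) refl ,
         to (window⇔ d l) (λ p q e → h (fsuc p) (fsuc q) (cong suc e)))
  backward
  where
  gapToHead : (∀ p q → toℕ q ≡ toℕ p + suc d → Gap (part (x ∷ l) p) (part (x ∷ l) q)) →
              ∀ w → drop d l ≡ w → GapToHead x w
  gapToHead h []      _ = tt
  gapToHead h (z ∷ w) e =
    let (q , q≡d , l[q]≡z) = drop⇒lookup d l e in subst (Gap x) l[q]≡z (h fzero (fsuc q) (cong suc q≡d))
  backward : Window d (x ∷ l) → ∀ p q → toℕ q ≡ toℕ p + suc d → Gap (part (x ∷ l) p) (part (x ∷ l) q)
  backward (g , _) fzero (fsuc q) e with lookup⇒drop d l q (suc-injective e)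
  ... | w , drop≡ rewrite drop≡ = g
  backward (_ , w) (fsuc p) (fsuc q) e = from (window⇔ d l) w p q (suc-injective e)

HeadBelow : ℕ → List ℕ → Set
HeadBelow c []      = ⊤
HeadBelow c (z ∷ _) = z < c

all⇒headBelow : ∀ {c} xs → All (_< c) xs → HeadBelow c xs
all⇒headBelow []      _       = tt
all⇒headBelow (x ∷ _) (p ∷ _) = p

headBelow-drop : ∀ c r e ν → All (c ≤_) e → All (_< c) ν →
  HeadBelow c (drop r (e ++ ν)) ⇔ (length e ≤ r)
headBelow-drop c r       []      ν _         ν<c = mk⇔ (λ _ → z≤n) (λ _ → all⇒headBelow _ (drop⁺ r ν<c))
headBelow-drop c zero    (x ∷ e) ν (c≤x ∷ _) _   = mk⇔ (λ x<c → ⊥-elim (<⇒≱ x<c c≤x)) (λ ())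
headBelow-drop c (suc r) (x ∷ e) ν (_ ∷ c≤e) ν<c = mk⇔
  (λ h → s≤s (to (headBelow-drop c r e ν c≤e ν<c) h))
  (λ le → from (headBelow-drop c r e ν c≤e ν<c) (≤-pred le))

-- A value  x ≥ c  whose admissible parts d+1 positions later are exactly
-- those below c; the top values  c+2, c+1  (c even) are of this kind.
TopValue : ℕ → ℕ → Set
TopValue c x = c ≤ x × (∀ z → Gap x z ⇔ (z < c))

gapToHead⇔headBelow : ∀ {c x} w → (∀ z → Gap x z ⇔ (z < c)) → GapToHead x w ⇔ HeadBelow c w
gapToHead⇔headBelow []      _   = mk⇔ (λ _ → tt) (λ _ → tt)
gapToHead⇔headBelow (z ∷ _) gap = gap z

window-++ : ∀ d c μ e ν → All (TopValue c) μ → All (c ≤_) e → All (_< c) ν →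
  length e ≤ suc d →
  Window d (μ ++ e ++ ν) ⇔ (Window d (e ++ ν) × length μ + length e ≤ suc d)
window-++ d c []      e ν _ _ _ e≤ = mk⇔ (λ w → w , e≤) proj₁
window-++ d c (x ∷ μ) e ν ((c≤x , gap) ∷ μ-top) c≤e ν<c e≤ = mk⇔
  (λ (g , w) → proj₁ (to ih w) , s≤s (from junction⇔ g))
  (λ (w , le) → to junction⇔ (≤-pred le) , from ih (w , ≤-trans (n≤1+n _) le))
  where
  ih = window-++ d c μ e ν μ-top c≤e ν<c e≤
  c≤μ++e : All (c ≤_) (μ ++ e)
  c≤μ++e = ++⁺ (all-map proj₁ μ-top) c≤e
  junction⇔ : length μ + length e ≤ d ⇔ GapToHead x (drop d (μ ++ e ++ ν))
  junction⇔ = mk⇔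
    (λ le → from (gapToHead⇔headBelow _ gap)
       (subst (λ u → HeadBelow c (drop d u)) (++-assoc μ e ν)
         (from (headBelow-drop c d (μ ++ e) ν c≤μ++e ν<c) (subst (_≤ d) (sym (length-++ μ)) le))))
    (λ g → subst (_≤ d) (length-++ μ)
       (to (headBelow-drop c d (μ ++ e) ν c≤μ++e ν<c)
         (subst (λ u → HeadBelow c (drop d u)) (sym (++-assoc μ e ν)) (to (gapToHead⇔headBelow _ gap) g))))

window-replicate : ∀ d y v r → Window d (replicate y v ++ r) → y ≤ suc d
window-replicate d y v r w with y ≤? suc d
... | yes y≤d+1 = y≤d+1
... | no  y≰d+1 = ⊥-elim (too-long y (≰⇒> y≰d+1) w)
  where
  drop-replicate : ∀ m y → m < y → ∃ λ u → drop m (replicate y v ++ r) ≡ v ∷ u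
  drop-replicate zero    (suc y) _   = _ , refl
  drop-replicate (suc m) (suc y) m<y = drop-replicate m y (≤-pred m<y)
  too-long : ∀ y → suc d < y → Window d (replicate y v ++ r) → ⊥
  too-long (suc y) d+1<y (g , _) with drop-replicate d y (≤-pred d+1<y)
  ... | u , drop≡ rewrite drop≡ = gap-irrefl v g

split-unique : ∀ B y x y′ x′ → All (B ≤_) y → All (_< B) x → All (B ≤_) y′ → All (_< B) x′ →
  y ++ x ≡ y′ ++ x′ → y ≡ y′ × x ≡ x′
split-unique B []      x []       x′ _ _ _ _ e = refl , e
split-unique B []      (z ∷ x) (w ∷ y′) x′ _ (z<B ∷ _) (B≤w ∷ _) _ refl = ⊥-elim (<⇒≱ z<B B≤w)
split-unique B (w ∷ y) x []       (z ∷ x′) (B≤w ∷ _) _ _ (z<B ∷ _) refl = ⊥-elim (<⇒≱ z<B B≤w)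
split-unique B (w ∷ y) x (w′ ∷ y′) x′ (_ ∷ B≤y) x<B (_ ∷ B≤y′) x′<B e
  with ∷-injective e
... | refl , e′ with split-unique B y x y′ x′ B≤y x<B B≤y′ x′<B e′
...   | refl , refl = refl , refl

descending-++ : ∀ B a b → All (B ≤_) a → All (_< B) b →
  Descending (a ++ b) ⇔ (Descending a × Descending b)
descending-++ B []      b _          _   = mk⇔ (λ d → tt , d) proj₂
descending-++ B (x ∷ a) b (B≤x ∷ B≤a) b<B = mk⇔
  (λ (x-top , d) → let (da , db) = to ih d in (++⁻ˡ a x-top , da) , db)
  (λ ((x-top , da) , db) → ++⁺ x-top (all-map (λ z<B → ≤-trans (<⇒≤ z<B) B≤x) b<B) , from ih (da , db))
  where ih = descending-++ B a b B≤a b<B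

oddDistinct-++ : ∀ B a b → All (B ≤_) a → All (_< B) b →
  OddDistinct (a ++ b) ⇔ (OddDistinct a × OddDistinct b)
oddDistinct-++ B []      b _          _   = mk⇔ (λ o → tt , o) proj₂
oddDistinct-++ B (x ∷ a) b (B≤x ∷ B≤a) b<B = mk⇔
  (λ (x-rep , o) → let (oa , ob) = to ih o in (++⁻ˡ a x-rep , oa) , ob)
  (λ ((x-rep , oa) , ob) → ++⁺ x-rep (all-map (λ z<B z≡x → ⊥-elim (<⇒≱ z<B (subst (B ≤_) (sym z≡x) B≤x))) b<B) ,
                            from ih (oa , ob))
  where ih = oddDistinct-++ B a b B≤a b<B

descending-suffix : ∀ a b → Descending (a ++ b) → Descending b
descending-suffix []      b d       = d
descending-suffix (x ∷ a) b (_ , d) = descending-suffix a b d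

window-suffix : ∀ d a b → Window d (a ++ b) → Window d b
window-suffix d []      b w       = w
window-suffix d (x ∷ a) b (_ , w) = window-suffix d a b w

split-top : ∀ v w → All (_≤ v) w → Descending w →
  ∃ λ n → ∃ λ rest → w ≡ replicate n v ++ rest × All (_< v) rest
split-top v []      _          _        = 0 , [] , refl , []
split-top v (z ∷ w) (z≤v ∷ w≤v) (w≤z , d) with z ≟ v
... | yes refl = let (n , rest , w≡ , rest<v) = split-top v w w≤v d in suc n , rest , cong (v ∷_) w≡ , rest<v
... | no  z≢v  = 0 , z ∷ w , refl , z<v ∷ all-map (λ y≤z → ≤-<-trans y≤z z<v) w≤z
  where z<v = ≤∧≢⇒< z≤v z≢v

replicate-unique : ∀ v p q a b → All (_< v) a → All (_< v) b →
  replicate p v ++ a ≡ replicate q v ++ b → p ≡ q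
replicate-unique v zero    zero    a       b       _         _         _    = refl
replicate-unique v zero    (suc q) (z ∷ a) b       (z<v ∷ _) _         refl = ⊥-elim (<-irrefl refl z<v)
replicate-unique v (suc p) zero    a       (z ∷ b) _         (z<v ∷ _) refl = ⊥-elim (<-irrefl refl z<v)
replicate-unique v (suc p) (suc q) a       b       a<v       b<v       e    =
  cong suc (replicate-unique v p q a b a<v b<v (proj₂ (∷-injective e)))

descending-replicate : ∀ n v → Descending (replicate n v)
descending-replicate zero    v = tt
descending-replicate (suc n) v = replicate⁺ n ≤-refl , descending-replicate n v

oddDistinct-replicate-even : ∀ n v → Even v → OddDistinct (replicate n v)
oddDistinct-replicate-even zero    v ev = tt
oddDistinct-replicate-even (suc n) v ev = replicate⁺ n (λ _ odd → odd ev) , oddDistinct-replicate-even n v ev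

oddDistinct-replicate-odd : ∀ n v → Odd v → OddDistinct (replicate n v) ⇔ (n ≤ 1)
oddDistinct-replicate-odd zero          v odd = mk⇔ (λ _ → z≤n) (λ _ → tt)
oddDistinct-replicate-odd (suc zero)    v odd = mk⇔ (λ _ → s≤s z≤n) (λ _ → [] , tt)
oddDistinct-replicate-odd (suc (suc n)) v odd = mk⇔ (λ { ((v-rep ∷ _) , _) → ⊥-elim (v-rep refl odd) }) (λ { (s≤s ()) })

sum-replicate : ∀ n v → sum (replicate n v) ≡ n * v
sum-replicate zero    v = refl
sum-replicate (suc n) v = cong (v +_) (sum-replicate n v)

part≤sum : ∀ l → All (_≤ sum l) l
part≤sum []      = []
part≤sum (x ∷ l) = m≤m+n x (sum l) ∷ all-map (λ z≤ → ≤-trans z≤ (m≤n+m (sum l) x)) (part≤sum l)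

≢-snoc : ∀ (xs : List ℕ) z → xs ≢ xs ++ z ∷ []
≢-snoc []       z ()
≢-snoc (x ∷ xs) z e = ≢-snoc xs z (proj₂ (∷-injective e))

-- The block contributed by a monomial of A'_(j) with  2j = 2+c:  L copies
-- of the even value 2+c followed by e copies of the odd value 1+c.
topBlock : ℕ → ℕ → ℕ → List ℕ
topBlock c L e = replicate L (2 + c) ++ replicate e (1 + c)

all-topBlock : ∀ {P : ℕ → Set} c L e → P (2 + c) → P (1 + c) → All P (topBlock c L e)
all-topBlock c L e p₂ p₁ = ++⁺ (replicate⁺ L p₂) (replicate⁺ e p₁)

length-topBlock : ∀ c L e → length (topBlock c L e) ≡ L + e
length-topBlock c L e = trans (length-++ (replicate L (2 + c))) (cong₂ _+_ (length-replicate L) (length-replicate e))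

topBlock-top : ∀ c L e → Even c → All (TopValue c) (topBlock c L e)
topBlock-top c L e ev =
  all-topBlock c L e (≤-trans (n≤1+n c) (n≤1+n (1 + c)) , λ z → gap-even-top z ev) (n≤1+n c , λ z → gap-odd-top z ev)

descending-topBlock : ∀ c L e → Descending (topBlock c L e)
descending-topBlock c L e =
  from (descending-++ (2 + c) (replicate L _) (replicate e _) (replicate⁺ L ≤-refl) (replicate⁺ e ≤-refl))
       (descending-replicate L _ , descending-replicate e _)

oddDistinct-topBlock : ∀ c L e → Even c → OddDistinct (topBlock c L e) ⇔ (e ≤ 1)
oddDistinct-topBlock c L e ev = mk⇔
  (λ o → to (oddDistinct-replicate-odd e _ (even⇒odd-suc ev)) (proj₂ (to split o)))
  (λ e≤1 → from split (oddDistinct-replicate-even L _ (even-+2 ev) , from (oddDistinct-replicate-odd e _ (even⇒odd-suc ev)) e≤1))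
  where split = oddDistinct-++ (2 + c) (replicate L _) (replicate e _) (replicate⁺ L ≤-refl) (replicate⁺ e ≤-refl)

sum-topBlock : ∀ c L e → sum (topBlock c L e) ≡ L * (2 + c) + e * (1 + c)
sum-topBlock c L e = trans (sum-++ (replicate L (2 + c)) (replicate e (1 + c))) (cong₂ _+_ (sum-replicate L _) (sum-replicate e _))

-- The degrees of the two monomials  q^{2j(l-1)},  q^{2jl-1}  (2j = 2+c)  are
-- the sizes of the blocks with e = 0, 1 copies of the odd value.
sum-topBlock₀ : ∀ c L → (2 + c) * L ≡ sum (topBlock c L 0)
sum-topBlock₀ c L = begin
  (2 + c) * L          ≡⟨ *-comm (2 + c) L ⟩
  L * (2 + c)          ≡⟨ sym (+-identityʳ _) ⟩
  L * (2 + c) + 0      ≡⟨ sym (sum-topBlock c L 0) ⟩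
  sum (topBlock c L 0) ∎
  where open ≡-Reasoning

sum-topBlock₁ : ∀ c L → (2 + c) * suc L ∸ 1 ≡ sum (topBlock c L 1)
sum-topBlock₁ c L = begin
  (2 + c) * suc L ∸ 1           ≡⟨ cong (_∸ 1) (*-suc (2 + c) L) ⟩
  (1 + c) + (2 + c) * L         ≡⟨ +-comm (1 + c) _ ⟩
  (2 + c) * L + (1 + c)         ≡⟨ cong₂ _+_ (*-comm (2 + c) L) (sym (+-identityʳ _)) ⟩
  L * (2 + c) + 1 * (1 + c)     ≡⟨ sym (sum-topBlock c L 1) ⟩
  sum (topBlock c L 1)          ∎
  where open ≡-Reasoning

TopRun : ℕ → ℕ → List ℕ → Set
TopRun top L λs = ∃ λ ν → λs ≡ replicate L top ++ ν × All (_< top) ν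

top-split : ∀ c L λs → Descending λs → TopRun (2 + c) L λs →
  ∃ λ e → ∃ λ y₀ → ∃ λ x′ → λs ≡ topBlock c L e ++ replicate y₀ c ++ x′ × All (_< c) x′
top-split c L .(replicate L (2 + c) ++ ν) d (ν , refl , ν<2+c)
  with split-top (1 + c) ν (all-map ≤-pred ν<2+c) (descending-suffix (replicate L _) ν d)
... | e , x , refl , x<1+c
  with split-top c x (all-map ≤-pred x<1+c)
         (descending-suffix (replicate e _) x (descending-suffix (replicate L _) ν d))
... | y₀ , x′ , refl , x′<c = e , y₀ , x′ , sym (++-assoc (replicate L (2 + c)) (replicate e (1 + c)) x) , x′<c

module Layers (D J : ℕ) where

  k : ℕ
  k = suc (suc D)

  InRange : ℕ → ℕ → Set
  InRange top z = 2 * J < z × z ≤ top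

  record Shape (top : ℕ) (λs : List ℕ) : Set where
    constructor shape
    field
      descending  : Descending λs
      inRange     : All (InRange top) λs
      oddDistinct : OddDistinct λs
      window      : Window D λs

  Layer : ℕ → ℕ → ℕ → ℕ → List ℕ → Set
  Layer top i l t λs = Shape top λs × countBorder J λs ≤ k ∸ i × 1 ≤ l × TopRun top (l ∸ 1) λs × sum λs ≡ t

  IsBorder : ℕ → Set
  IsBorder b = T ((b ≡ᵇ 2 * J + 1) ∨ (b ≡ᵇ 2 * J + 2))

  isBorder? : ∀ b → Dec (IsBorder b)
  isBorder? b = T? ((b ≡ᵇ 2 * J + 1) ∨ (b ≡ᵇ 2 * J + 2))

  countBorder-above : ∀ μ x → All (2 + 2 * J <_) μ → countBorder J (μ ++ x) ≡ countBorder J x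
  countBorder-above μ x above = cong length (begin
    filter isBorder? (μ ++ x)                  ≡⟨ filter-++ isBorder? μ x ⟩
    filter isBorder? μ ++ filter isBorder? x   ≡⟨ cong (_++ filter isBorder? x) (filter-none isBorder? (all-map not-border above)) ⟩
    filter isBorder? x                         ∎)
    where
    open ≡-Reasoning
    not-border : ∀ {b} → 2 + 2 * J < b → ¬ IsBorder b
    not-border {b} above isB with to T-∨ isB
    ... | inj₁ b≡ = <⇒≱ (subst (2 + 2 * J <_) (≡ᵇ⇒≡ b _ b≡) above) (≤-trans (≤-reflexive (+-comm (2 * J) 1)) (n≤1+n _))
    ... | inj₂ b≡ = <⇒≱ (subst (2 + 2 * J <_) (≡ᵇ⇒≡ b _ b≡) above) (≤-reflexive (+-comm (2 * J) 2))

  countBorder-topBlock : ∀ L e → countBorder J (topBlock (2 * J) L e) ≡ L + e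
  countBorder-topBlock L e = trans
    (cong length (filter-all isBorder? (all-topBlock (2 * J) L e
       (from T-∨ (inj₂ (≡⇒≡ᵇ _ _ (+-comm 2 (2 * J))))) (from T-∨ (inj₁ (≡⇒≡ᵇ _ _ (+-comm 1 (2 * J))))))))
    (length-topBlock (2 * J) L e)

  shape-split : ∀ {c} L e y₀ x′ → Even c → 2 * J ≤ c → All (_< c) x′ →
    Shape (2 + c) (topBlock c L e ++ replicate y₀ c ++ x′) ⇔
    (e ≤ 1 × L + e + y₀ ≤ suc D × Shape c (replicate y₀ c ++ x′))
  shape-split {c} L e y₀ x′ ev 2J≤c x′<c = mk⇔ forward backward
    where
    B = topBlock c L e
    x = replicate y₀ c ++ x′
    x≤c : All (_≤ c) x
    x≤c = ++⁺ (replicate⁺ y₀ ≤-refl) (all-map <⇒≤ x′<c)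
    B>c : All (1 + c ≤_) B
    B>c = all-topBlock c L e (n≤1+n _) ≤-refl
    desc = descending-++ (1 + c) B x B>c (all-map s≤s x≤c)
    odd  = oddDistinct-++ (1 + c) B x B>c (all-map s≤s x≤c)
    junction : y₀ ≤ suc D → Window D (B ++ x) ⇔ (Window D x × length B + length (replicate y₀ c) ≤ suc D)
    junction y₀≤ = window-++ D c B (replicate y₀ c) x′ (topBlock-top c L e ev) (replicate⁺ y₀ ≤-refl) x′<c
                     (subst (_≤ suc D) (sym (length-replicate y₀)) y₀≤)
    length-B+y₀ : length B + length (replicate y₀ c) ≡ L + e + y₀
    length-B+y₀ = cong₂ _+_ (length-topBlock c L e) (length-replicate y₀)
    forward : Shape (2 + c) (B ++ x) → e ≤ 1 × L + e + y₀ ≤ suc D × Shape c x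
    forward (shape d r o w) =
      to (oddDistinct-topBlock c L e ev) (proj₁ (to odd o)) ,
      subst (_≤ suc D) length-B+y₀ (proj₂ (to (junction (window-replicate D y₀ c x′ wx)) w)) ,
      shape (proj₂ (to desc d)) (zipWith (λ ((2J< , _) , ≤c) → 2J< , ≤c) (++⁻ʳ B r , x≤c)) (proj₂ (to odd o)) wx
      where wx = window-suffix D B x w
    backward : e ≤ 1 × L + e + y₀ ≤ suc D × Shape c x → Shape (2 + c) (B ++ x)
    backward (e≤1 , bound , shape d r o w) = shape
      (from desc (descending-topBlock c L e , d))
      (++⁺ (all-topBlock c L e (≤-trans (s≤s 2J≤c) (n≤1+n _) , ≤-refl) (s≤s 2J≤c , n≤1+n _))
           (all-map (λ (2J< , ≤c) → 2J< , ≤-trans ≤c (≤-trans (n≤1+n c) (n≤1+n _))) r))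
      (from odd (from (oddDistinct-topBlock c L e ev) e≤1 , o))
      (from (junction (window-replicate D y₀ c x′ w)) (w , subst (_≤ suc D) (sym length-B+y₀) bound))

  level : ℕ → ℕ
  level n = 2 * (J + n)

  Counted : ℕ → ℕ → ℕ → ℕ → List ℕ → Set
  Counted zero    i l t λs = i ≡ l × t ≡ 0 × λs ≡ []
  Counted (suc n) i l t λs = Layer (level (suc n)) i l t λs

  Split : (ℕ → ℕ → List ℕ → Set) → ℕ → ℕ → ℕ → List ℕ → Set
  Split P c L t λs = ∃ λ y₀ → ∃ λ e → ∃ λ x →
    e ≤ 1 × L + e + y₀ ≤ suc D × P (suc y₀) (sum x) x × λs ≡ topBlock c L e ++ x × sum λs ≡ t

  layer-step : ∀ {top c} i L t → top ≡ 2 + c → Even c → 2 + 2 * J ≤ c →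
    ∀ λs → Layer top i (suc L) t λs ⇔ Split (Layer c i) c L t λs
  layer-step {c = c} i L t refl ev 2J+2≤c λs = mk⇔ (forward λs) (backward λs)
    where
    2J≤c : 2 * J ≤ c
    2J≤c = ≤-trans (m≤n+m _ 2) 2J+2≤c
    B-above : ∀ e → All (2 + 2 * J <_) (topBlock c L e)
    B-above e = all-topBlock c L e (s≤s (≤-trans 2J+2≤c (n≤1+n c))) (s≤s 2J+2≤c)
    forward : ∀ λs → Layer (2 + c) i (suc L) t λs → Split (Layer c i) c L t λs
    forward λs (sh , border , _ , run , s) with top-split c L λs (Shape.descending sh) run
    ... | e , y₀ , x′ , refl , x′<c =
      let (e≤1 , bound , sh-x) = to (shape-split L e y₀ x′ ev 2J≤c x′<c) sh
          x = replicate y₀ c ++ x′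
      in y₀ , e , x , e≤1 , bound ,
         (sh-x , subst (_≤ k ∸ i) (countBorder-above _ x (B-above e)) border , s≤s z≤n , (x′ , refl , x′<c) , refl) ,
         refl , s
    backward : ∀ λs → Split (Layer c i) c L t λs → Layer (2 + c) i (suc L) t λs
    backward _ (y₀ , e , x , e≤1 , bound , (sh-x , border , _ , (x′ , refl , x′<c) , _) , refl , s) =
      from (shape-split L e y₀ x′ ev 2J≤c x′<c) (e≤1 , bound , sh-x) ,
      subst (_≤ k ∸ i) (sym (countBorder-above _ x (B-above e))) border ,
      s≤s z≤n ,
      (replicate e (1 + c) ++ x , ++-assoc (replicate L (2 + c)) _ x ,
       ++⁺ (replicate⁺ e ≤-refl) (all-map (λ (_ , ≤c) → s≤s (≤-trans ≤c (n≤1+n c))) (Shape.inRange sh-x))) ,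
      s

  empty-tail : ∀ y₀ x′ → All (InRange (2 * J)) (replicate y₀ (2 * J) ++ x′) → y₀ ≡ 0 × x′ ≡ []
  empty-tail zero    []      _                 = refl , refl
  empty-tail zero    (z ∷ _) ((2J<z , z≤2J) ∷ _) = ⊥-elim (<⇒≱ 2J<z z≤2J)
  empty-tail (suc y₀) _      ((2J<2J , _) ∷ _)  = ⊥-elim (<-irrefl refl 2J<2J)

  -- Peeling the top block off the first stage: the junction with the i-1
  -- phantom parts of the identity matrix is condition (5).
  layer-base : ∀ {top c} i L t → top ≡ 2 + c → c ≡ 2 * J → 1 ≤ i → i ≤ k →
    ∀ λs → Layer top i (suc L) t λs ⇔ Split (Counted 0 i) c L t λs
  layer-base (suc i₀) L t refl refl _ i≤k λs = mk⇔ (forward λs) (backward λs)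
    where
    i₀≤ : i₀ ≤ suc D
    i₀≤ = ≤-pred i≤k
    border≡ : ∀ e → countBorder J (topBlock (2 * J) L e ++ []) ≡ L + e
    border≡ e = trans (cong (countBorder J) (++-identityʳ (topBlock (2 * J) L e))) (countBorder-topBlock L e)
    forward : ∀ λs → Layer (2 + 2 * J) (suc i₀) (suc L) t λs → Split (Counted 0 (suc i₀)) (2 * J) L t λs
    forward λs (sh , border , _ , run , s) with top-split (2 * J) L λs (Shape.descending sh) run
    ... | e , y₀ , x′ , refl , x′<2J
      with to (shape-split L e y₀ x′ (even-double J) ≤-refl x′<2J) sh
    ... | e≤1 , _ , sh-x with empty-tail y₀ x′ (Shape.inRange sh-x)
    ...   | refl , refl =
      i₀ , e , [] , e≤1 , m≤o∸n⇒m+n≤o (L + e) i₀≤ (subst (_≤ suc D ∸ i₀) (border≡ e) border) ,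
      (refl , refl , refl) , refl , s
    backward : ∀ λs → Split (Counted 0 (suc i₀)) (2 * J) L t λs → Layer (2 + 2 * J) (suc i₀) (suc L) t λs
    backward _ (_ , e , _ , e≤1 , bound , (refl , _ , refl) , refl , s) =
      from (shape-split L e 0 [] (even-double J) ≤-refl [])
           (e≤1 , ≤-trans (+-monoʳ-≤ (L + e) z≤n) bound , shape tt [] tt tt) ,
      subst (_≤ suc D ∸ i₀) (sym (border≡ e)) (m+n≤o⇒m≤o∸n (L + e) bound) ,
      s≤s z≤n ,
      (replicate e (1 + 2 * J) ++ [] , ++-assoc (replicate L (2 + 2 * J)) _ [] , ++⁺ (replicate⁺ e ≤-refl) []) ,
      s

  -- The monomials of the (m,l) entry of A'_(j), with  top = 2j,  read as the
  -- block of parts they contribute at degree s.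
  Block : ℕ → ℕ → ℕ → ℕ → List ℕ → Set
  Block top m l s y =
      (l ≤ (k ∸ m) + 1 × (s ≡ top * (l ∸ 1) × y ≡ replicate (l ∸ 1) top))
    ⊎ (l ≤ k ∸ m × (s ≡ top * l ∸ 1 × y ≡ replicate (l ∸ 1) top ++ (top ∸ 1) ∷ []))

  counts-block : ∀ j m l s → Counts (A′ k j m l s) (Block (2 * j) m l s)
  counts-block j m l s = counts-⊎
    (counts-if (l ≤ᵇ (k ∸ m) + 1) _ (≤ᵇ⇒≤ _ _) ≤⇒≤ᵇ (counts-mono _ s _))
    (counts-if (l ≤ᵇ k ∸ m) _ (≤ᵇ⇒≤ _ _) ≤⇒≤ᵇ (counts-mono _ s _))
    (λ y (_ , _ , y≡) (_ , _ , y≡′) → ≢-snoc _ _ (trans (sym y≡) y≡′))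

  block⇔ : ∀ c y₀ L s y → y₀ ≤ suc D →
    Block (2 + c) (suc y₀) (suc L) s y ⇔
    (∃ λ e → e ≤ 1 × L + e + y₀ ≤ suc D × y ≡ topBlock c L e × s ≡ sum (topBlock c L e))
  block⇔ c y₀ L s y y₀≤ = mk⇔ forward backward
    where
    fits : ∀ n → n ≤ suc D ∸ y₀ ⇔ n + y₀ ≤ suc D
    fits n = mk⇔ (m≤o∸n⇒m+n≤o n y₀≤) (m+n≤o⇒m≤o∸n n)
    fits₀ : suc L ≤ (suc D ∸ y₀) + 1 ⇔ L + 0 + y₀ ≤ suc D
    fits₀ = mk⇔
      (λ le → subst (λ n → n + y₀ ≤ suc D) (sym (+-identityʳ L)) (to (fits L) (≤-pred (subst (suc L ≤_) (+-comm _ 1) le))))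
      (λ le → subst (suc L ≤_) (+-comm 1 _) (s≤s (from (fits L) (subst (λ n → n + y₀ ≤ suc D) (+-identityʳ L) le))))
    fits₁ : suc L ≤ suc D ∸ y₀ ⇔ L + 1 + y₀ ≤ suc D
    fits₁ = mk⇔
      (λ le → subst (λ n → n + y₀ ≤ suc D) (+-comm 1 L) (to (fits (suc L)) le))
      (λ le → from (fits (suc L)) (subst (λ n → n + y₀ ≤ suc D) (+-comm L 1) le))
    forward : Block (2 + c) (suc y₀) (suc L) s y →
      ∃ λ e → e ≤ 1 × L + e + y₀ ≤ suc D × y ≡ topBlock c L e × s ≡ sum (topBlock c L e)
    forward (inj₁ (fit , s≡ , refl)) = 0 , z≤n , to fits₀ fit , sym (++-identityʳ _) , trans s≡ (sum-topBlock₀ c L)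
    forward (inj₂ (fit , s≡ , refl)) = 1 , s≤s z≤n , to fits₁ fit , refl , trans s≡ (sum-topBlock₁ c L)
    backward : (∃ λ e → e ≤ 1 × L + e + y₀ ≤ suc D × y ≡ topBlock c L e × s ≡ sum (topBlock c L e)) →
      Block (2 + c) (suc y₀) (suc L) s y
    backward (0 , _ , fit , y≡ , s≡) =
      inj₁ (from fits₀ fit , trans s≡ (sym (sum-topBlock₀ c L)) , trans y≡ (++-identityʳ _))
    backward (1 , _ , fit , y≡ , s≡) = inj₂ (from fits₁ fit , trans s≡ (sym (sum-topBlock₁ c L)) , y≡)
    backward (suc (suc e) , s≤s () , _)

  block-above : ∀ {top c m l s y} → top ≡ 2 + c → Block top m l s y → All (c <_) y
  block-above refl (inj₁ (_ , _ , refl)) = replicate⁺ _ (n≤1+n _)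
  block-above refl (inj₂ (_ , _ , refl)) = ++⁺ (replicate⁺ _ (n≤1+n _)) (≤-refl ∷ [])

  -- The set counted by the q^t coefficient of the (i,l) entry of  H · A'_(j)
  -- when the entries of H count P:  λs = y ++ x  with x from column m of H
  -- at degree a and y a block of the (m,l) entry of A'_(j) at degree t-a.
  Step : (ℕ → ℕ → List ℕ → Set) → ℕ → ℕ → ℕ → List ℕ → Set
  Step P top l t λs = ∃ λ m → 1 ≤ m × m < 1 + k × (∃ λ a → 0 ≤ a × a < 0 + suc t ×
    (∃ λ x → ∃ λ y → P m a x × Block top m l (t ∸ a) y × λs ≡ y ++ x))

  step⇔split : ∀ {P top c} L t → top ≡ 2 + c → (∀ {m a x} → P m a x → sum x ≡ a) →
    ∀ λs → Step P top (suc L) t λs ⇔ Split P c L t λs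
  step⇔split {P} {c = c} L t refl size λs = mk⇔ (forward λs) (backward λs)
    where
    forward : ∀ λs → Step P (2 + c) (suc L) t λs → Split P c L t λs
    forward _ (suc y₀ , _ , m<1+k , a , _ , a<1+t , x , y , p , blk , refl)
      with to (block⇔ c y₀ L (t ∸ a) y (≤-pred (≤-pred m<1+k))) blk
    ... | e , e≤1 , fit , refl , s≡ =
      y₀ , e , x , e≤1 , fit , subst (λ a → P (suc y₀) a x) (sym (size p)) p , refl , total
      where
      total : sum (topBlock c L e ++ x) ≡ t
      total = begin
        sum (topBlock c L e ++ x)       ≡⟨ sum-++ (topBlock c L e) x ⟩
        sum (topBlock c L e) + sum x    ≡⟨ cong₂ _+_ (sym s≡) (size p) ⟩
        t ∸ a + a                       ≡⟨ m∸n+n≡m (≤-pred a<1+t) ⟩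
        t                               ∎
        where open ≡-Reasoning
    backward : ∀ λs → Split P c L t λs → Step P (2 + c) (suc L) t λs
    backward _ (y₀ , e , x , e≤1 , fit , p , refl , total) =
      suc y₀ , s≤s z≤n , s≤s (s≤s y₀≤) , sum x , z≤n , s≤s x≤t , x , topBlock c L e , p ,
      from (block⇔ c y₀ L (t ∸ sum x) _ y₀≤) (e , e≤1 , fit , refl , rest) , refl
      where
      B = topBlock c L e
      y₀≤ : y₀ ≤ suc D
      y₀≤ = ≤-trans (m≤n+m y₀ (L + e)) fit
      split-total : sum B + sum x ≡ t
      split-total = trans (sym (sum-++ B x)) total
      x≤t : sum x ≤ t
      x≤t = subst (sum x ≤_) split-total (m≤n+m (sum x) (sum B))
      rest : t ∸ sum x ≡ sum B
      rest = trans (cong (_∸ sum x) (sym split-total)) (m+n∸n≡m (sum B) (sum x))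

  level-suc : ∀ n → level (suc n) ≡ 2 + level n
  level-suc n = trans (cong (2 *_) (+-suc J n)) (*-suc 2 (J + n))

  level-zero : level 0 ≡ 2 * J
  level-zero = cong (2 *_) (+-identityʳ J)

  2J+2≤level : ∀ n → 2 + 2 * J ≤ level (suc n)
  2J+2≤level n = subst (_≤ level (suc n)) (trans (level-suc 0) (cong (2 +_) level-zero))
                       (*-monoʳ-≤ 2 (+-monoʳ-≤ J (s≤s z≤n)))

  counted⇔split : ∀ n i L t → 1 ≤ i → i ≤ k →
    ∀ λs → Counted (suc n) i (suc L) t λs ⇔ Split (Counted n i) (level n) L t λs
  counted⇔split zero    i L t 1≤i i≤k = layer-base i L t (level-suc 0) level-zero 1≤i i≤k
  counted⇔split (suc n) i L t _   _   =
    layer-step i L t (level-suc (suc n)) (even-double (J + suc n)) (2J+2≤level n)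

  counted-sum : ∀ n {i m a x} → Counted n i m a x → sum x ≡ a
  counted-sum zero    (_ , refl , refl) = refl
  counted-sum (suc n) (_ , _ , _ , _ , s) = s

  counted-bound : ∀ n {i m a x} → Counted n i m a x → All (_< 1 + level n) x
  counted-bound zero    (_ , _ , refl) = []
  counted-bound (suc n) (sh , _)       = all-map (λ (_ , ≤top) → s≤s ≤top) (Shape.inRange sh)

  counted-index : ∀ n {i m m′ a a′ x} → Counted n i m a x → Counted n i m′ a′ x → m ≡ m′
  counted-index zero    (refl , _) (refl , _) = refl
  counted-index (suc n) (_ , _ , s≤s z≤n , (ν , x≡ , ν<) , _) (_ , _ , s≤s z≤n , (ν′ , x≡′ , ν′<) , _) =
    cong suc (replicate-unique _ _ _ ν ν′ ν< ν′< (trans (sym x≡) x≡′))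

  decomposition-unique : ∀ n {i top m m′ a a′ l s s′ x x′ y y′} → top ≡ level (suc n) →
    Counted n i m a x → Block top m l s y → Counted n i m′ a′ x′ → Block top m′ l s′ y′ →
    y ++ x ≡ y′ ++ x′ → x ≡ x′ × y ≡ y′
  decomposition-unique n {m = m} {m′} top≡ cx by cx′ by′ e =
    let (y≡ , x≡) = split-unique (1 + level n) _ _ _ _
                      (block-above {m = m} (trans top≡ (level-suc n)) by) (counted-bound n cx)
                      (block-above {m = m′} (trans top≡ (level-suc n)) by′) (counted-bound n cx′) e
    in x≡ , y≡

  counts-counted : ∀ n i l t → 1 ≤ i → i ≤ k → 1 ≤ l → Counts (hprod k J n i l t) (Counted n i l t)
  counts-counted zero    i l       t _   _   _ =
    counts-if (i ≡ᵇ l) (mono 0) (≡ᵇ⇒≡ i l) (≡⇒≡ᵇ i l) (counts-mono 0 t [])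
  counts-counted (suc n) i (suc L) t 1≤i i≤k _ =
    enum-⇔ product λ λs → mk⇔
      (λ st → from (counted⇔split n i L t 1≤i i≤k λs) (to (step⇔split L t (level-suc n) (counted-sum n) λs) st))
      (λ c → from (step⇔split L t (level-suc n) (counted-sum n) λs) (to (counted⇔split n i L t 1≤i i≤k λs) c))
    where
    top = level (suc n)
    Pair : ℕ → ℕ → List ℕ → Set
    Pair m a λs = ∃ λ x → ∃ λ y → Counted n i m a x × Block top m (suc L) (t ∸ a) y × λs ≡ y ++ x
    same-tail : ∀ {m m′ a a′ λs} → Pair m a λs → Pair m′ a′ λs → ∃ λ x → Counted n i m a x × Counted n i m′ a′ x
    same-tail (x , y , cx , by , refl) (x′ , y′ , cx′ , by′ , e) with decomposition-unique n refl cx by cx′ by′ e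
    ... | refl , _ = x , cx , cx′
    product : Counts (hprod k J (suc n) i (suc L) t) (Step (Counted n i) top (suc L) t)
    product = counts-sumFrom 1 k _ (λ m λs → ∃ λ a → 0 ≤ a × a < 0 + suc t × Pair m a λs)
      (λ m 1≤m _ → counts-sumFrom 0 (suc t) _ (Pair m)
         (λ a _ _ → counts-++ (counts-counted n i m a 1≤i i≤k 1≤m) (counts-block (J + suc n) m (suc L) (t ∸ a))
                              (decomposition-unique n refl))
         (λ p p′ → let (x , cx , cx′) = same-tail p p′ in trans (sym (counted-sum n cx)) (counted-sum n cx′)))
      (λ (_ , _ , _ , p) (_ , _ , _ , p′) → let (x , cx , cx′) = same-tail p p′ in counted-index n cx cx′)

  -- Once the top value exceeds t, the (i,1) set is exactly the set of
  -- partitions of t with (1)–(5): no part can reach the top.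
  layer-complete : ∀ top i t λs → t < top →
    Layer top i 1 t λs ⇔ (IsPartition λs × Conditions k J i λs × sum λs ≡ t)
  layer-complete top i t λs t<top = mk⇔ forward backward
    where
    forward : Layer top i 1 t λs → IsPartition λs × Conditions k J i λs × sum λs ≡ t
    forward (shape d r o w , border , _ , _ , s) =
      (from (all⇔lookup λs) (all-map (λ (2J< , _) → ≤-trans (s≤s z≤n) 2J<) r) , from (descending⇔ λs) d) ,
      (from (oddDistinct⇔ λs) o , from (window⇔ D λs) w , from (all⇔lookup λs) (all-map proj₁ r) , border) ,
      s
    backward : IsPartition λs × Conditions k J i λs × sum λs ≡ t → Layer top i 1 t λs
    backward ((_ , d) , (o , w , r , border) , s) =
      shape (to (descending⇔ λs) d)
            (zipWith (λ (2J< , <top) → 2J< , <⇒≤ <top) (to (all⇔lookup λs) r , below))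
            (to (oddDistinct⇔ λs) o)
            (to (window⇔ D λs) w) ,
      border , s≤s z≤n , (λs , refl , below) , s
      where
      below : All (_< top) λs
      below = all-map (λ z≤ → ≤-<-trans z≤ (subst (_< top) (sym s) t<top)) (part≤sum λs)

  counts-stable : ∀ n i t → 1 ≤ i → i ≤ k → t < n →
    Counts (hprod k J n i 1 t) (λ λs → IsPartition λs × Conditions k J i λs × sum λs ≡ t)
  counts-stable (suc n) i t 1≤i i≤k t<n =
    enum-⇔ (counts-counted (suc n) i 1 t 1≤i i≤k ≤-refl) λ λs → layer-complete (level (suc n)) i t λs t<level
    where
    t<level : t < level (suc n)
    t<level = ≤-trans t<n (≤-trans (m≤n+m (suc n) J) (m≤m+n (J + suc n) _))

proposition6p2 : (k J i : ℕ) → 2 ≤ k → 1 ≤ i → i ≤ k →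
    ∀ (t : ℕ) → ∃ λ (N : ℕ) → ∀ (j : ℕ) → N ≤ j →
    Counts (hMat k J j i 1 t)
    (λ l → IsPartition l × Conditions k J i l × sum l ≡ t)
proposition6p2 (suc (suc D)) J i (s≤s (s≤s z≤n)) 1≤i i≤k t = J + suc t , λ j N≤j →
  Layers.counts-stable D J (j ∸ J) i t 1≤i i≤k
    (subst (_≤ j ∸ J) (m+n∸m≡n J (suc t)) (∸-monoˡ-≤ J N≤j))
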